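{- For all terms $t, s$, the following are equivalent: (1) $\mathsf{LANG} \not\models t \le s$; (2) there is a words-to-letters valuation $\mathfrak{w}$ such that $\hat{\mathfrak{w}}(t) \not\subseteq \hat{\mathfrak{w}}(s)$.
   Context: Let $\mathbf{V}$ be a set of variables. Terms are generated by $t, s ::= x \mid \mathrm{I} \mid \bot \mid t \cdot s \mid t \cup s \mid t^{*} \mid x^{ - }$ ($x \in \mathbf{V}$). For a set $X$, a language over $X$ is a subset of $X^{*}$ (empty word $\mathrm{I}$); $L_1 \cdot L_2 = \{uv \mid u \in L_1, v \in L_2\}$, $L^{*} = \{u_0\cdots u_{n-1} \mid n \ge 0, u_i \in L\}$. A language valuation over $X$ is a map $\mathfrak{v}$ from variables to languages over $X$, extended to terms $\hat{\mathfrak{v}}$ by $\hat{\mathfrak{v}}(\mathrm{I}) = \{\mathrm{I}\}$, $\hat{\mathfrak{v}}(\bot) = \emptyset$, $\hat{\mathfrak{v}}(t\cdot s) = \hat{\mathfrak{v}}(t)\cdot\hat{\mathfrak{v}}(s)$, $\hat{\mathfrak{v}}(t \cup s) = \hat{\mathfrak{v}}(t)\cup\hat{\mathfrak{v}}(s)$, $\hat{\mathfrak{v}}(t^{*}) = \hat{\mathfrak{v}}(t)^{*}$, $\hat{\mathfrak{v}}(x^{ - }) = X^{*} \setminus \mathfrak{v}(x)$. $\mathsf{LANG} \models t \le s$ means $\hat{\mathfrak{v}}(t) \subseteq \hat{\mathfrak{v}}(s)$ for every language valuation $\mathfrak{v}$ over every set. Words-to-letters valuations: for a language valuation $\mathfrak{v}$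 over $X$ and words $w_0, \dots, w_{n-1}$ over $X$ ($n \ge 0$), let $\ell_0, \dots, \ell_{n-1}$ be pairwise distinct letters and define the language valuation $\mathfrak{v}^{\langle w_0, \dots, w_{n-1}\rangle}$ over $\{\ell_0, \dots, \ell_{n-1}\}$ by $\mathfrak{v}^{\langle w_0, \dots, w_{n-1}\rangle}(x) = \{\ell_i \cdots \ell_{j-1} \mid 0 \le i \le j \le n,\ w_i \cdots w_{j-1} \in \mathfrak{v}(x)\}$. A words-to-letters valuation is any valuation of this form. -}

module Defs where

open import Data.Nat using (ℕ; _≤_; _∸_)
open import Data.Fin using (Fin)
open import Data.List using (List; []; _∷_; _++_; concat; take; drop; allFin)
open import Data.List.Relation.Unary.All using (All)
open import Data.Vec using (Vec; toList)
open import Data.Product using (Σ; ∃; ∃₂; _×_; _,_)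
open import Relation.Nullary using (¬_)
open import Relation.Binary.PropositionalEquality using (_≡_)

data Term (V : Set) : Set where
  var  : V → Term V
  I    : Term V
  ⊥    : Term V
  _·_  : Term V → Term V → Term V
  _∪_  : Term V → Term V → Term V
  _*   : Term V → Term V
  _⁻   : V → Term V

Lang : Set → Set₁
Lang X = List X → Set

module _ {X : Set} where

  _⊙_ : Lang X → Lang X → Lang X
  (L₁ ⊙ L₂) w = ∃₂ λ u v → (w ≡ u ++ v) × L₁ u × L₂ v

  Star : Lang X → Lang X
  Star L w = ∃ λ (us : List (List X)) → All L us × (concat us ≡ w)

  _⊆L_ : Lang X → Lang X → Set
  L₁ ⊆L L₂ = ∀ w → L₁ w → L₂ w

  _⊈L_ : Lang X → Lang X → Set
  L₁ ⊈L L₂ = ∃ λ w → L₁ w × ¬ L₂ w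

⟦_⟧ : {V X : Set} → Term V → (V → Lang X) → Lang X
⟦ var x ⟧ 𝔳 = 𝔳 x
⟦ I ⟧ 𝔳 w = w ≡ []
⟦ ⊥ ⟧ 𝔳 w = Data.Empty.⊥
  where import Data.Empty
⟦ t · s ⟧ 𝔳 = ⟦ t ⟧ 𝔳 ⊙ ⟦ s ⟧ 𝔳
⟦ t ∪ s ⟧ 𝔳 w = Data.Sum._⊎_ (⟦ t ⟧ 𝔳 w) (⟦ s ⟧ 𝔳 w)
  where import Data.Sum
⟦ t * ⟧ 𝔳 = Star (⟦ t ⟧ 𝔳)
⟦ x ⁻ ⟧ 𝔳 w = ¬ 𝔳 x w

LANG⊨ : {V : Set} → Term V → Term V → Set₁
LANG⊨ {V} t s = (X : Set) (𝔳 : V → Lang X) → ⟦ t ⟧ 𝔳 ⊆L ⟦ s ⟧ 𝔳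

LANG⊭ : {V : Set} → Term V → Term V → Set₁
LANG⊭ {V} t s = Σ Set λ X → Σ (V → Lang X) λ 𝔳 → ⟦ t ⟧ 𝔳 ⊈L ⟦ s ⟧ 𝔳

segment : {A : Set} → ℕ → ℕ → List A → List A
segment i j l = take (j ∸ i) (drop i l)

-- Words-to-letters valuation 𝔳^⟨w₀,…,w_{n-1}⟩, over the letters
-- ℓ₀,…,ℓ_{n-1} taken to be the elements of Fin n (ℓᵢ = i):
--   x ↦ { ℓᵢ⋯ℓ_{j-1} | 0 ≤ i ≤ j ≤ n, wᵢ⋯w_{j-1} ∈ 𝔳(x) }
wordsToLetters : {V X : Set} {n : ℕ} → (V → Lang X) → Vec (List X) n → V → Lang (Fin n)
wordsToLetters {n = n} 𝔳 ws x u =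
  ∃₂ λ i j → i ≤ j × j ≤ n × (u ≡ segment i j (allFin n))
           × 𝔳 x (concat (segment i j (toList ws)))

W2L⊭ : {V : Set} → Term V → Term V → Set₁
W2L⊭ {V} t s =
  Σ Set λ X → Σ (V → Lang X) λ 𝔳 → Σ ℕ λ n → Σ (Vec (List X) n) λ ws →
    ⟦ t ⟧ (wordsToLetters 𝔳 ws) ⊈L ⟦ s ⟧ (wordsToLetters 𝔳 ws)

{-# OPTIONS --safe #-}
module Submission where

open import Defs
open import Function.Bundles using (_⇔_; mk⇔; Equivalence)

open import Data.Nat using (ℕ; _+_; _≤_)
open import Data.Nat.Properties using (m≤m+n; ≤-trans; ≤-reflexive; +-assoc; module ≤-Reasoning)
open import Data.Fin using (Fin)
open import Data.List using (List; []; _∷_; _++_; [_]; concat; take; drop; allFin; map; length; lookup)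
open import Data.List.Properties
  using (∷-injective; ++-assoc; ++-identityʳ; map-++; length-++; take-map; drop-map;
         concat-map; concat-map-[_]; map-tabulate; tabulate-lookup; length-tabulate)
open import Data.List.Relation.Unary.All as All using (All; []; _∷_)
import Data.List.Relation.Unary.All.Properties as All
open import Data.Vec as Vec using (Vec)
import Data.Vec.Properties as Vec
open import Data.Product using (∃; ∃₂; _×_; _,_)
open import Data.Sum.Function.Propositional using (_⊎-⇔_)
open import Function.Base using (id)
open import Relation.Binary.PropositionalEquality
  using (_≡_; refl; sym; trans; cong; subst; module ≡-Reasoning)

open Equivalence using (to; from)

-- Given a word w refuting t ≤ s under 𝔳, take as letters the positions of w and
-- the words-to-letters valuation of the one-letter words of w.  Reading positions
-- back as letters of w is letter-to-letter, so any factorisation of the image of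
-- a word lifts to a factorisation of the word itself; hence on factors of the
-- word of all positions the two valuations agree on every term (an equivalence
-- rather than an inclusion, as complements of variables swap the directions).

_InfixOf_ : {A : Set} → List A → List A → Set
u InfixOf l = ∃₂ λ p q → l ≡ p ++ u ++ q

infix-refl : {A : Set} (l : List A) → l InfixOf l
infix-refl l = [] , [] , sym (++-identityʳ l)

infix-++⁻ : {A : Set} {l : List A} (a : List A) {b : List A} →
            (a ++ b) InfixOf l → a InfixOf l × b InfixOf l
infix-++⁻ a {b} (p , q , refl) =
  (p , b ++ q , cong (p ++_) (++-assoc a b q)) ,
  (p ++ a , q , trans (cong (p ++_) (++-assoc a b q)) (sym (++-assoc p a (b ++ q))))

concat-infix⁻ : {A : Set} {l : List A} (us : List (List A)) →
                concat us InfixOf l → All (_InfixOf l) us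
concat-infix⁻ []       _ = []
concat-infix⁻ (u ∷ us) i = let iu , ius = infix-++⁻ u i in iu ∷ concat-infix⁻ us ius

module _ {A B : Set} (f : A → B) where

  map-≡-[] : (u : List A) → map f u ≡ [] → u ≡ []
  map-≡-[] [] _ = refl

  map-≡-++ : (a : List B) {b : List B} (u : List A) → map f u ≡ a ++ b →
             ∃₂ λ u₁ u₂ → u ≡ u₁ ++ u₂ × map f u₁ ≡ a × map f u₂ ≡ b
  map-≡-++ []      u       e = [] , u , refl , refl , e
  map-≡-++ (x ∷ a) (y ∷ u) e with ∷-injective e
  ... | refl , e′ with map-≡-++ a u e′
  ...   | u₁ , u₂ , refl , refl , refl = y ∷ u₁ , u₂ , refl , refl , refl

  map-≡-concat : (as : List (List B)) (u : List A) → map f u ≡ concat as →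
                 ∃ λ us → u ≡ concat us × map (map f) us ≡ as
  map-≡-concat []       u e = [] , map-≡-[] u e , refl
  map-≡-concat (a ∷ as) u e with map-≡-++ a u e
  ... | u₁ , u₂ , refl , refl , e₂ with map-≡-concat as u₂ e₂
  ...   | us , refl , refl = u₁ ∷ us , refl , refl

module LetterMap {V X Y : Set} (f : Y → X) (𝔳 : V → Lang X) (𝔴 : V → Lang Y) (l : List Y)
  (var⇔ : ∀ x {u} → u InfixOf l → 𝔴 x u ⇔ 𝔳 x (map f u)) where

  ⟦⟧-map⇔ : ∀ t {u} → u InfixOf l → ⟦ t ⟧ 𝔴 u ⇔ ⟦ t ⟧ 𝔳 (map f u)
  ⟦⟧-map⇔ (var x) i = var⇔ x i
  ⟦⟧-map⇔ I {u} _ = mk⇔ (λ { refl → refl }) (map-≡-[] f u)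
  ⟦⟧-map⇔ ⊥ _ = mk⇔ (λ ()) (λ ())
  ⟦⟧-map⇔ (t · s) {u} i = mk⇔ forward backward
    where
    forward : ⟦ t · s ⟧ 𝔴 u → ⟦ t · s ⟧ 𝔳 (map f u)
    forward (u₁ , u₂ , refl , h₁ , h₂) =
      let i₁ , i₂ = infix-++⁻ u₁ i in
      map f u₁ , map f u₂ , map-++ f u₁ u₂ , to (⟦⟧-map⇔ t i₁) h₁ , to (⟦⟧-map⇔ s i₂) h₂
    backward : ⟦ t · s ⟧ 𝔳 (map f u) → ⟦ t · s ⟧ 𝔴 u
    backward (a , b , e , h₁ , h₂) with map-≡-++ f a u e
    ... | u₁ , u₂ , refl , refl , refl =
      let i₁ , i₂ = infix-++⁻ u₁ i in
      u₁ , u₂ , refl , from (⟦⟧-map⇔ t i₁) h₁ , from (⟦⟧-map⇔ s i₂) h₂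
  ⟦⟧-map⇔ (t ∪ s) i = ⟦⟧-map⇔ t i ⊎-⇔ ⟦⟧-map⇔ s i
  ⟦⟧-map⇔ (t *) {u} i = mk⇔ forward backward
    where
    forward : ⟦ t * ⟧ 𝔴 u → ⟦ t * ⟧ 𝔳 (map f u)
    forward (us , hs , refl) =
      map (map f) us ,
      All.map⁺ (All.zipWith (λ (iv , h) → to (⟦⟧-map⇔ t iv) h) (concat-infix⁻ us i , hs)) ,
      concat-map us
    backward : ⟦ t * ⟧ 𝔳 (map f u) → ⟦ t * ⟧ 𝔴 u
    backward (as , hs , e) with map-≡-concat f as u (sym e)
    ... | us , refl , refl =
      us , All.zipWith (λ (iv , h) → from (⟦⟧-map⇔ t iv) h) (concat-infix⁻ us i , All.map⁻ hs) ,
      refl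
  ⟦⟧-map⇔ (x ⁻) i = mk⇔ (λ ∉𝔴 h → ∉𝔴 (from (var⇔ x i) h)) (λ ∉𝔳 h → ∉𝔳 (to (var⇔ x i) h))

segment-map : {A B : Set} (f : A → B) (i j : ℕ) (l : List A) →
              segment i j (map f l) ≡ map f (segment i j l)
segment-map f i j l = trans (cong (take _) (drop-map i l)) (take-map _ (drop i l))

take-length-++ : {A : Set} (u q : List A) → take (length u) (u ++ q) ≡ u
take-length-++ []      q = refl
take-length-++ (x ∷ u) q = cong (x ∷_) (take-length-++ u q)

segment-infix : {A : Set} (p u q : List A) →
                segment (length p) (length p + length u) (p ++ u ++ q) ≡ u
segment-infix []      u q = take-length-++ u q
segment-infix (x ∷ p) u q = segment-infix p u q

infix-end-≤ : {A : Set} {l : List A} (p u q : List A) → l ≡ p ++ u ++ q →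
              length p + length u ≤ length l
infix-end-≤ p u q refl = begin
  length p + length u                  ≤⟨ m≤m+n _ (length q) ⟩
  length p + length u + length q       ≡⟨ +-assoc (length p) (length u) (length q) ⟩
  length p + (length u + length q)     ≡⟨ cong (length p +_) (length-++ u) ⟨
  length p + length (u ++ q)           ≡⟨ length-++ p ⟨
  length (p ++ u ++ q)                 ∎
  where open ≤-Reasoning

module _ {X : Set} (w : List X) where

  positions : List (Fin (length w))
  positions = allFin (length w)

  letters : Vec (List X) (length w)
  letters = Vec.map [_] (Vec.fromList w)

  map-lookup-positions : map (lookup w) positions ≡ w
  map-lookup-positions = trans (map-tabulate id (lookup w)) (tabulate-lookup w)

  letters-segment : ∀ i j →
                    concat (segment i j (Vec.toList letters)) ≡ map (lookup w) (segment i j positions)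
  letters-segment i j = begin
    concat (segment i j (Vec.toList letters))  ≡⟨ cong (λ ws → concat (segment i j ws)) toList-letters ⟩
    concat (segment i j (map [_] w))           ≡⟨ cong concat (segment-map [_] i j w) ⟩
    concat (map [_] (segment i j w))           ≡⟨ concat-map-[ segment i j w ] ⟩
    segment i j w                              ≡⟨ cong (segment i j) map-lookup-positions ⟨
    segment i j (map (lookup w) positions)     ≡⟨ segment-map (lookup w) i j positions ⟩
    map (lookup w) (segment i j positions)     ∎
    where
    open ≡-Reasoning
    toList-letters : Vec.toList letters ≡ map [_] w
    toList-letters = trans (Vec.toList-map [_] (Vec.fromList w)) (cong (map [_]) (Vec.toList∘fromList w))

module _ {V X : Set} (𝔳 : V → Lang X) (w : List X) where

  wordsToLetters-var⇔ : ∀ x {u} → u InfixOf positions w →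
                        wordsToLetters 𝔳 (letters w) x u ⇔ 𝔳 x (map (lookup w) u)
  wordsToLetters-var⇔ x {u} (p , q , e) = mk⇔ forward backward
    where
    forward : wordsToLetters 𝔳 (letters w) x u → 𝔳 x (map (lookup w) u)
    forward (i , j , _ , _ , refl , h) = subst (𝔳 x) (letters-segment w i j) h
    start end : ℕ
    start = length p
    end   = length p + length u
    u-segment : segment start end (positions w) ≡ u
    u-segment = trans (cong (segment start end) e) (segment-infix p u q)
    u-letters : concat (segment start end (Vec.toList (letters w))) ≡ map (lookup w) u
    u-letters = trans (letters-segment w start end) (cong (map (lookup w)) u-segment)
    backward : 𝔳 x (map (lookup w) u) → wordsToLetters 𝔳 (letters w) x u
    backward h =
      start , end , m≤m+n start (length u) ,
      ≤-trans (infix-end-≤ p u q e) (≤-reflexive (length-tabulate id)) ,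
      sym u-segment , subst (𝔳 x) (sym u-letters) h

  wordsToLetters-⟦⟧⇔ : ∀ t → ⟦ t ⟧ (wordsToLetters 𝔳 (letters w)) (positions w) ⇔ ⟦ t ⟧ 𝔳 w
  wordsToLetters-⟦⟧⇔ t =
    subst (⟦ t ⟧ (wordsToLetters 𝔳 (letters w)) (positions w) ⇔_)
          (cong (⟦ t ⟧ 𝔳) (map-lookup-positions w))
          (⟦⟧-map⇔ t (infix-refl (positions w)))
    where open LetterMap (lookup w) 𝔳 (wordsToLetters 𝔳 (letters w)) (positions w) wordsToLetters-var⇔

corollary5p10 : {V : Set} (t s : Term V) → LANG⊭ t s ⇔ W2L⊭ t s
corollary5p10 t s = mk⇔ refine coarsen
  where
  refine : LANG⊭ t s → W2L⊭ t s
  refine (X , 𝔳 , w , w∈t , w∉s) =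
    X , 𝔳 , length w , letters w , positions w ,
    from (wordsToLetters-⟦⟧⇔ 𝔳 w t) w∈t ,
    λ positions∈s → w∉s (to (wordsToLetters-⟦⟧⇔ 𝔳 w s) positions∈s)
  coarsen : W2L⊭ t s → LANG⊭ t s
  coarsen (X , 𝔳 , n , ws , refutation) = Fin n , wordsToLetters 𝔳 ws , refutation
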